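{- Let $n$ be a positive integer having at least two distinct prime divisors, and let $p_1,p_2$ be its two largest prime divisors. If $p_1>3$ and $p_2>3$, then $f(n)\leq \frac{5n}{p_1p_2}$.
   Context: For a positive integer $n$, $f(n)$ denotes the least positive integer $a$ such that $a(a+2)$ is coprime to $n$. -}

module Defs where

open import Data.Nat using (ℕ; _+_; _*_; _<_; _≤_)
open import Data.Nat.Coprimality using (Coprime)
open import Data.Product using (_×_)

IsF : ℕ → ℕ → Set
IsF n a = (0 < a × Coprime (a * (a + 2)) n)
        × (∀ b → 0 < b → Coprime (b * (b + 2)) n → a ≤ b)

-- Write n = p₁ p₂ m and look at b ∈ {m − 1, 2m − 1, …, 5m − 1}. Each such b satisfies b ≡ −1 and
-- b + 2 ≡ 1 (mod m), so b(b + 2) is coprime to m, and b(b + 2) fails to be coprime to p₁ p₂ only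
-- if one of the four conditions p₁ ∣ b, p₁ ∣ b + 2, p₂ ∣ b, p₂ ∣ b + 2 holds. A prime p ≥ 5 coprime
-- to m divides at most one term of an arithmetic progression of length 5 with difference m, so
-- each condition holds for at most one of the five candidates and, by pigeonhole, one candidate
-- satisfies none of them. Hence f(n) ≤ 5m − 1.
module Submission where

open import Defs
open import Data.Nat using (ℕ; zero; suc; _+_; _*_; _∸_; _<_; _≤_; z<s; >-nonZero; nonTrivial⇒≢1)
open import Data.Nat.Properties
open import Data.Nat.Divisibility
  using (_∣_; divides; _∣?_; ∣-trans; ∣m+n∣m⇒∣n; ∣n⇒∣m*n; ∣⇒≤; ∣1⇒≡1)
open import Data.Nat.Primality
  using (Prime; prime⇒irreducible; prime⇒nonZero; prime⇒nonTrivial; euclidsLemma; composite⇒¬prime; composite[4])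
open import Data.Nat.Coprimality
  using (Coprime; coprime-divisor; prime⇒coprime; 0-coprimeTo-m⇒m≡1)
  renaming (sym to coprime-sym)
open import Data.Nat.Tactic.RingSolver using (solve-∀)
open import Data.Fin using (Fin; toℕ)
open import Data.Fin.Patterns using (0F; 1F; 2F; 3F)
open import Data.Fin.Properties using (pigeonhole; toℕ<n; ¬∀⟶∃¬; any?)
open import Data.Vec using (_∷_; []; lookup)
open import Data.Sum using (_⊎_; inj₁; inj₂)
open import Data.Product using (∃-syntax; _,_; _×_; proj₁)
open import Relation.Nullary using (¬_; contradiction)
open import Relation.Binary.PropositionalEquality using (_≡_; _≢_; refl; sym; trans; cong; subst; module ≡-Reasoning)

prime⇒≢1 : ∀ {p} → Prime p → p ≢ 1
prime⇒≢1 p-prime = nonTrivial⇒≢1 {{prime⇒nonTrivial p-prime}}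

prime∤⇒coprime : ∀ {p x} → Prime p → ¬ p ∣ x → Coprime x p
prime∤⇒coprime p-prime p∤x {d} (d∣x , d∣p) with prime⇒irreducible p-prime d∣p
... | inj₁ d≡1    = d≡1
... | inj₂ refl = contradiction d∣x p∤x

coprime-*ˡ : ∀ {a b c} → Coprime a c → Coprime b c → Coprime (a * b) c
coprime-*ˡ {a} {b} {c} a⊥c b⊥c {d} (d∣ab , d∣c) = b⊥c (coprime-divisor d⊥a d∣ab , d∣c)
  where
  d⊥a : Coprime d a
  d⊥a (e∣d , e∣a) = a⊥c (e∣a , ∣-trans e∣d d∣c)

coprime-*ʳ : ∀ {a b c} → Coprime a b → Coprime a c → Coprime a (b * c)
coprime-*ʳ a⊥b a⊥c = coprime-sym (coprime-*ˡ (coprime-sym a⊥b) (coprime-sym a⊥c))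

coprime-+-* : ∀ {y m} k → Coprime y m → Coprime (y + k * m) m
coprime-+-* {y} {m} k y⊥m {d} (d∣y+km , d∣m) =
  y⊥m (∣m+n∣m⇒∣n (subst (d ∣_) (+-comm y (k * m)) d∣y+km) (∣n⇒∣m*n k d∣m) , d∣m)

coprime-suc : ∀ n → Coprime n (suc n)
coprime-suc n {d} (d∣n , d∣1+n) = ∣1⇒≡1 (∣m+n∣m⇒∣n (subst (d ∣_) (+-comm 1 n) d∣1+n) d∣n)

coprime-∣⇒*∣ : ∀ {a b c} → Coprime a b → a ∣ c → b ∣ c → a * b ∣ c
coprime-∣⇒*∣ {a} {b} {c} a⊥b (divides q c≡qa) b∣c
  with divides r q≡rb ← coprime-divisor (coprime-sym a⊥b) (subst (b ∣_) (trans c≡qa (*-comm q a)) b∣c) =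
  divides r (begin
    c           ≡⟨ c≡qa ⟩
    q * a       ≡⟨ cong (_* a) q≡rb ⟩
    r * b * a   ≡⟨ *-assoc r b a ⟩
    r * (b * a) ≡⟨ cong (r *_) (*-comm b a) ⟩
    r * (a * b) ∎)
  where open ≡-Reasoning

prime>3⇒prime≥5 : ∀ {p} → Prime p → 3 < p → 5 ≤ p
prime>3⇒prime≥5 p-prime 3<p with m≤n⇒m<n∨m≡n 3<p
... | inj₁ 4<p = 4<p
... | inj₂ refl = contradiction p-prime (composite⇒¬prime composite[4])

prime∣x⇒∤x+d*m : ∀ {p x m d} → Prime p → Coprime x m → 0 < d → d < p → p ∣ x → ¬ p ∣ x + d * m
prime∣x⇒∤x+d*m {p} {x} {m} {d} p-prime x⊥m 0<d d<p p∣x p∣x+dm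
  with euclidsLemma d m p-prime (∣m+n∣m⇒∣n p∣x+dm p∣x)
... | inj₁ p∣d = <⇒≱ d<p (∣⇒≤ {{>-nonZero 0<d}} p∣d)
... | inj₂ p∣m = prime⇒≢1 p-prime (x⊥m (p∣x , p∣m))

+-*-split : ∀ y m {i j} → i ≤ j → y + j * m ≡ (y + i * m) + (j ∸ i) * m
+-*-split y m {i} {j} i≤j = begin
  y + j * m                   ≡⟨ cong (λ k → y + k * m) (sym (m+[n∸m]≡n i≤j)) ⟩
  y + (i + (j ∸ i)) * m       ≡⟨ cong (y +_) (*-distribʳ-+ m i (j ∸ i)) ⟩
  y + (i * m + (j ∸ i) * m)   ≡⟨ sym (+-assoc y (i * m) ((j ∸ i) * m)) ⟩
  (y + i * m) + (j ∸ i) * m   ∎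
  where open ≡-Reasoning

prime-∣-at-most-one-term : ∀ {p y m i j} → Prime p → Coprime y m → i < j → j < p →
                           p ∣ y + i * m → ¬ p ∣ y + j * m
prime-∣-at-most-one-term {p} {y} {m} {i} {j} p-prime y⊥m i<j j<p p∣yᵢ p∣yⱼ =
  prime∣x⇒∤x+d*m p-prime (coprime-+-* i y⊥m) (m<n⇒0<n∸m i<j) (≤-<-trans (m∸n≤m j i) j<p) p∣yᵢ
    (subst (p ∣_) (+-*-split y m (<⇒≤ i<j)) p∣yⱼ)

∃-index-avoiding-primes : ∀ {r N m} (q y : Fin r → ℕ) → r < N →
                          (∀ k → Prime (q k)) → (∀ k → N ≤ q k) → (∀ k → Coprime (y k) m) →
                          ∃[ i ] ¬ (∃[ k ] q k ∣ y k + toℕ i * m)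
∃-index-avoiding-primes {r} {N} {m} q y r<N q-prime N≤q y⊥m =
  ¬∀⟶∃¬ N Covered (λ i → any? (λ k → q k ∣? y k + toℕ i * m)) allCovered⇒⊥
  where
  Covered : Fin N → Set
  Covered i = ∃[ k ] q k ∣ y k + toℕ i * m

  allCovered⇒⊥ : ¬ (∀ i → Covered i)
  allCovered⇒⊥ covered with i , j , i<j , kᵢ≡kⱼ ← pigeonhole r<N (λ i → proj₁ (covered i))
    with kᵢ , q∣yᵢ ← covered i | kⱼ , q∣yⱼ ← covered j =
    prime-∣-at-most-one-term (q-prime kᵢ) (y⊥m kᵢ) i<j (<-≤-trans (toℕ<n j) (N≤q kᵢ)) q∣yᵢ
      (subst (λ k → q k ∣ y k + toℕ j * m) (sym kᵢ≡kⱼ) q∣yⱼ)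

coprime-shifted-product⇒positive : ∀ {b n p} → Prime p → p ∣ n → Coprime (b * (b + 2)) n → 0 < b
coprime-shifted-product⇒positive {zero} p-prime p∣n 0⊥n with refl ← 0-coprimeTo-m⇒m≡1 0⊥n =
  contradiction (∣1⇒≡1 p∣n) (prime⇒≢1 p-prime)
coprime-shifted-product⇒positive {suc b} _ _ _ = z<s

∃-small-coprime-shifted-product : ∀ {p₁ p₂ m} → Prime p₁ → Prime p₂ → 5 ≤ p₁ → 5 ≤ p₂ → 0 < m →
                                  ∃[ b ] b ≤ 5 * m × Coprime (b * (b + 2)) (m * (p₁ * p₂))
∃-small-coprime-shifted-product {p₁} {p₂} {m@(suc u)} p₁-prime p₂-prime 5≤p₁ 5≤p₂ _ =
  candidate (∃-index-avoiding-primes q y ≤-refl q-prime 5≤q y⊥m)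
  where
  -- For the candidate b = u + i m, the term y k + i m is b for even k and b + 2 for odd k.
  q y : Fin 4 → ℕ
  q = lookup (p₁ ∷ p₁ ∷ p₂ ∷ p₂ ∷ [])
  y = lookup (u ∷ suc m ∷ u ∷ suc m ∷ [])

  q-prime : ∀ k → Prime (q k)
  q-prime = λ { 0F → p₁-prime ; 1F → p₁-prime ; 2F → p₂-prime ; 3F → p₂-prime }

  5≤q : ∀ k → 5 ≤ q k
  5≤q = λ { 0F → 5≤p₁ ; 1F → 5≤p₁ ; 2F → 5≤p₂ ; 3F → 5≤p₂ }

  suc-coprime : Coprime (suc m) m
  suc-coprime = coprime-sym (coprime-suc m)

  y⊥m : ∀ k → Coprime (y k) m
  y⊥m = λ { 0F → coprime-suc u ; 1F → suc-coprime ; 2F → coprime-suc u ; 3F → suc-coprime }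

  coprime-to-all : ∀ {x} → Coprime x m → ¬ p₁ ∣ x → ¬ p₂ ∣ x → Coprime x (m * (p₁ * p₂))
  coprime-to-all x⊥m p₁∤x p₂∤x =
    coprime-*ʳ x⊥m (coprime-*ʳ (prime∤⇒coprime p₁-prime p₁∤x) (prime∤⇒coprime p₂-prime p₂∤x))

  candidate : ∃[ i ] ¬ (∃[ k ] q k ∣ y k + toℕ i * m) →
              ∃[ b ] b ≤ 5 * m × Coprime (b * (b + 2)) (m * (p₁ * p₂))
  candidate (i , uncovered) =
    b , b≤5m , coprime-*ˡ (coprime-to-all b⊥m (λ p₁∣b → uncovered (0F , p₁∣b))
                                              (λ p₂∣b → uncovered (2F , p₂∣b)))
                          (coprime-to-all b+2⊥m (λ p₁∣b+2 → uncovered (1F , subst (p₁ ∣_) b+2≡ p₁∣b+2))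
                                                (λ p₂∣b+2 → uncovered (3F , subst (p₂ ∣_) b+2≡ p₂∣b+2)))
    where
    b : ℕ
    b = u + toℕ i * m

    b≤5m : b ≤ 5 * m
    b≤5m = +-mono-≤ (n≤1+n u) (*-monoˡ-≤ m (≤-pred (toℕ<n i)))

    b+2≡ : b + 2 ≡ suc m + toℕ i * m
    b+2≡ = +-+2-comm u (toℕ i * m)
      where
      +-+2-comm : ∀ x z → x + z + 2 ≡ 2 + x + z
      +-+2-comm = solve-∀

    b⊥m : Coprime b m
    b⊥m = coprime-+-* (toℕ i) (coprime-suc u)

    b+2⊥m : Coprime (b + 2) m
    b+2⊥m = subst (λ x → Coprime x m) (sym b+2≡) (coprime-+-* (toℕ i) suc-coprime)

lemma6 : (n p₁ p₂ a : ℕ) → 0 < n →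
    Prime p₁ → p₁ ∣ n → Prime p₂ → p₂ ∣ n → p₂ < p₁ →
    (∀ q → Prime q → q ∣ n → q ≡ p₁ ⊎ q ≤ p₂) →
    3 < p₁ → 3 < p₂ →
    IsF n a →
    a * (p₁ * p₂) ≤ 5 * n
lemma6 n p₁ p₂ a 0<n p₁-prime p₁∣n p₂-prime p₂∣n p₂<p₁ _ 3<p₁ 3<p₂ (_ , least) =
  bound (coprime-∣⇒*∣ (prime⇒coprime p₁-prime {{prime⇒nonZero p₂-prime}} p₂<p₁) p₁∣n p₂∣n)
  where
  bound : p₁ * p₂ ∣ n → a * (p₁ * p₂) ≤ 5 * n
  bound (divides m n≡m*p₁p₂) = bound-by-candidate (∃-small-coprime-shifted-product p₁-prime p₂-prime
                                 (prime>3⇒prime≥5 p₁-prime 3<p₁) (prime>3⇒prime≥5 p₂-prime 3<p₂) 0<m)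
    where
    0<m : 0 < m
    0<m = n≢0⇒n>0 λ { refl → <-irrefl refl (subst (0 <_) n≡m*p₁p₂ 0<n) }

    bound-by-candidate : ∃[ b ] b ≤ 5 * m × Coprime (b * (b + 2)) (m * (p₁ * p₂)) → a * (p₁ * p₂) ≤ 5 * n
    bound-by-candidate (b , b≤5m , b⊥m*p₁p₂) = begin
      a * (p₁ * p₂)       ≤⟨ *-monoˡ-≤ (p₁ * p₂) (least b 0<b b⊥n) ⟩
      b * (p₁ * p₂)       ≤⟨ *-monoˡ-≤ (p₁ * p₂) b≤5m ⟩
      5 * m * (p₁ * p₂)   ≡⟨ *-assoc 5 m (p₁ * p₂) ⟩
      5 * (m * (p₁ * p₂)) ≡⟨ cong (5 *_) n≡m*p₁p₂ ⟨
      5 * n               ∎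
      where
      open ≤-Reasoning
      b⊥n : Coprime (b * (b + 2)) n
      b⊥n = subst (Coprime _) (sym n≡m*p₁p₂) b⊥m*p₁p₂

      0<b : 0 < b
      0<b = coprime-shifted-product⇒positive p₁-prime p₁∣n b⊥n
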